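{- Let $G$ be a graph and let $v_1,v_2$ be adjacent vertices of $G$ with $\deg(v_1)=\deg(v_2)=2$. Then in any 2-burning sequence for $G$, at least one of $v_1,v_2$ is a source (i.e., appears in the sequence).
   Context: All graphs are finite and connected. The 2-burning process: given a graph $G$ and a sequence $s=(s_1,\dots,s_k)$ of vertices of $G$ (the sources), at round $0$ all vertices are uncolored; at each round $j\ge1$, (i) if $j\le k$ and $s_j$ is uncolored, $s_j$ is colored blue, and (ii) every uncolored vertex having at least two neighbors that were blue at the end of round $j-1$ is colored blue. $s$ is a 2-burning sequence for $G$ if eventually all vertices are blue. -}

module Defs where

open import Data.Nat using (ℕ; zero; suc; _+_; _≤_)
open import Data.Nat.Properties using (_≤?_)
open import Data.Fin using (Fin; zero; suc)
open import Data.Bool using (Bool; true; false; _∨_; if_then_else_)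
open import Data.List using (List; []; _∷_)
open import Data.Product using (∃)
open import Relation.Binary.PropositionalEquality using (_≡_)
open import Relation.Nullary.Decidable using (⌊_⌋)
open import Data.Fin using (_≟_)

record Graph : Set where
  field
    n      : ℕ
    adj    : Fin n → Fin n → Bool
    sym    : ∀ x y → adj x y ≡ adj y x
    irrefl : ∀ x → adj x x ≡ false

open Graph public

count : {m : ℕ} → (Fin m → Bool) → ℕ
count {zero}  p = 0
count {suc m} p = (if p zero then 1 else 0) + count (λ i → p (suc i))

deg : (G : Graph) → Fin (n G) → ℕ
deg G v = count (adj G v)

data Reach (G : Graph) : Fin (n G) → Fin (n G) → Set where
  here : ∀ {x} → Reach G x x
  step : ∀ {x y z} → adj G x y ≡ true → Reach G y z → Reach G x z

Connected : Graph → Set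
Connected G = ∀ x y → Reach G x y

-- is x the source chosen at round j+1 (i.e. x = s_{j+1}, 0-based index j)?
sourceAt : {m : ℕ} → List (Fin m) → ℕ → Fin m → Bool
sourceAt []      j       x = false
sourceAt (s ∷ _) zero    x = ⌊ s ≟ x ⌋
sourceAt (_ ∷ s) (suc j) x = sourceAt s j x

-- blue G s j x : is x blue at the end of round j of the 2-burning process
-- with source sequence s.  Once blue, a vertex stays blue.
blue : (G : Graph) → List (Fin (n G)) → ℕ → Fin (n G) → Bool
blue G s zero    x = false
blue G s (suc j) x =
  blue G s j x
  ∨ sourceAt s j x
  ∨ ⌊ 2 ≤? count (λ y → if adj G x y then blue G s j y else false) ⌋

Is2BurningSeq : (G : Graph) → List (Fin (n G)) → Set
Is2BurningSeq G s = ∃ λ t → ∀ x → blue G s t x ≡ true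

{-# OPTIONS --safe #-}
-- A vertex of degree two that is not a source turns blue only when both of
-- its neighbours were already blue.  So if neither of the adjacent degree-two
-- vertices v₁, v₂ is a source, each can turn blue only after the other has,
-- and by induction on the rounds neither ever does.
module Submission where

open import Defs hiding (sym)
open import Data.Bool using (Bool; true; false; _∨_; if_then_else_)
open import Data.Bool.Properties using (T-≡)
open import Data.Empty using (⊥-elim)
open import Data.Fin using (Fin; zero; suc; _≟_)
open import Data.List using (List; []; _∷_)
open import Data.List.Membership.Propositional using (_∈_)
open import Data.List.Relation.Unary.Any using (here; there)
open import Data.Nat using (ℕ; zero; suc; _≤_; _<_; z≤n; s≤s)
open import Data.Nat.Properties using (_≤?_; m≤n⇒m≤1+n; ≤⇒≯)
open import Data.Product using (_,_)
open import Data.Sum using (_⊎_; inj₁; inj₂)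
open import Function.Bundles using (Equivalence)
open import Relation.Binary.PropositionalEquality using (_≡_; refl; sym; trans; subst)
open import Relation.Nullary using (yes; no)
open import Relation.Nullary.Decidable using (toWitness)

∨-true : ∀ {a b} → a ∨ b ≡ true → a ≡ true ⊎ b ≡ true
∨-true {true}  _ = inj₁ refl
∨-true {false} e = inj₂ e

count-mono : ∀ {m} (p q : Fin m → Bool) → (∀ y → q y ≡ true → p y ≡ true) →
             count q ≤ count p
count-mono {zero}  p q q⇒p = z≤n
count-mono {suc m} p q q⇒p with q zero in q₀ | p zero in p₀
... | true  | true  = s≤s (count-mono _ _ (λ y → q⇒p (suc y)))
... | true  | false with () ← trans (sym (q⇒p zero q₀)) p₀
... | false | true  = m≤n⇒m≤1+n (count-mono _ _ (λ y → q⇒p (suc y)))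
... | false | false = count-mono _ _ (λ y → q⇒p (suc y))

count-mono-< : ∀ {m} (p q : Fin m → Bool) → (∀ y → q y ≡ true → p y ≡ true) →
               (z : Fin m) → p z ≡ true → q z ≡ false → count q < count p
count-mono-< {suc m} p q q⇒p zero pz qz rewrite pz | qz =
  s≤s (count-mono _ _ (λ y → q⇒p (suc y)))
count-mono-< {suc m} p q q⇒p (suc z) pz qz with q zero in q₀ | p zero in p₀
... | true  | true  = s≤s (count-mono-< _ _ (λ y → q⇒p (suc y)) z pz qz)
... | true  | false with () ← trans (sym (q⇒p zero q₀)) p₀
... | false | true  = m≤n⇒m≤1+n (count-mono-< _ _ (λ y → q⇒p (suc y)) z pz qz)
... | false | false = count-mono-< _ _ (λ y → q⇒p (suc y)) z pz qz

sourceAt⇒∈ : ∀ {m} (s : List (Fin m)) j x → sourceAt s j x ≡ true → x ∈ s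
sourceAt⇒∈ []      j       x ()
sourceAt⇒∈ (a ∷ s) zero    x e with a ≟ x
... | yes a≡x = here (sym a≡x)
... | no _    with () ← e
sourceAt⇒∈ (a ∷ s) (suc j) x e = there (sourceAt⇒∈ s j x e)

module _ (G : Graph) (s : List (Fin (n G))) where

  blueNeighbour : ℕ → Fin (n G) → Fin (n G) → Bool
  blueNeighbour j x y = if adj G x y then blue G s j y else false

  blueNeighbours : ℕ → Fin (n G) → ℕ
  blueNeighbours j x = count (blueNeighbour j x)

  blueNeighbour⇒adj : ∀ j x y → blueNeighbour j x y ≡ true → adj G x y ≡ true
  blueNeighbour⇒adj j x y e with adj G x y
  ... | true  = refl
  ... | false = e

  blueNeighbours<deg : ∀ j x y → adj G x y ≡ true → blue G s j y ≡ false →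
                       blueNeighbours j x < deg G x
  blueNeighbours<deg j x y xy y-white =
    count-mono-< (adj G x) (blueNeighbour j x) (blueNeighbour⇒adj j x) y xy not-blue
    where
    not-blue : blueNeighbour j x y ≡ false
    not-blue rewrite xy | y-white = refl

  blue-suc : ∀ j x → blue G s (suc j) x ≡ true →
             blue G s j x ≡ true ⊎ x ∈ s ⊎ 2 ≤ blueNeighbours j x
  blue-suc j x e with ∨-true e
  ... | inj₁ was-blue = inj₁ was-blue
  ... | inj₂ e′ with ∨-true e′
  ...   | inj₁ source = inj₂ (inj₁ (sourceAt⇒∈ s j x source))
  ...   | inj₂ spread =
    inj₂ (inj₂ (toWitness {a? = 2 ≤? blueNeighbours j x} (Equivalence.from T-≡ spread)))

  deg-two-blue-suc : ∀ j x y → deg G x ≡ 2 → adj G x y ≡ true → blue G s (suc j) x ≡ true →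
                     blue G s j x ≡ true ⊎ x ∈ s ⊎ blue G s j y ≡ true
  deg-two-blue-suc j x y deg₂ xy e with blue G s j y in y-colour | blue-suc j x e
  ... | true  | _                 = inj₂ (inj₂ refl)
  ... | false | inj₁ was-blue     = inj₁ was-blue
  ... | false | inj₂ (inj₁ x∈s)   = inj₂ (inj₁ x∈s)
  ... | false | inj₂ (inj₂ two≤) =
    ⊥-elim (≤⇒≯ two≤ (subst (blueNeighbours j x <_) deg₂ (blueNeighbours<deg j x y xy y-colour)))

  deg-two-edge-blue⇒source : ∀ {v₁ v₂} → adj G v₁ v₂ ≡ true → deg G v₁ ≡ 2 → deg G v₂ ≡ 2 →
                             ∀ j → blue G s j v₁ ≡ true ⊎ blue G s j v₂ ≡ true →
                             v₁ ∈ s ⊎ v₂ ∈ s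
  deg-two-edge-blue⇒source {v₁} {v₂} v₁v₂ deg₁ deg₂ = go
    where
    v₂v₁ : adj G v₂ v₁ ≡ true
    v₂v₁ = trans (Graph.sym G v₂ v₁) v₁v₂

    go : ∀ j → blue G s j v₁ ≡ true ⊎ blue G s j v₂ ≡ true → v₁ ∈ s ⊎ v₂ ∈ s
    go zero (inj₁ ())
    go zero (inj₂ ())
    go (suc j) (inj₁ b) with deg-two-blue-suc j v₁ v₂ deg₁ v₁v₂ b
    ... | inj₁ b′         = go j (inj₁ b′)
    ... | inj₂ (inj₁ v∈s) = inj₁ v∈s
    ... | inj₂ (inj₂ b′)  = go j (inj₂ b′)
    go (suc j) (inj₂ b) with deg-two-blue-suc j v₂ v₁ deg₂ v₂v₁ b
    ... | inj₁ b′         = go j (inj₂ b′)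
    ... | inj₂ (inj₁ v∈s) = inj₂ v∈s
    ... | inj₂ (inj₂ b′)  = go j (inj₁ b′)

lemma2 : (G : Graph) → Connected G → (v₁ v₂ : Fin (n G)) → adj G v₁ v₂ ≡ true → deg G v₁ ≡ 2 → deg G v₂ ≡ 2 → (s : List (Fin (n G))) → Is2BurningSeq G s → v₁ ∈ s ⊎ v₂ ∈ s
lemma2 G _ v₁ v₂ v₁v₂ deg₁ deg₂ s (t , all-blue) =
  deg-two-edge-blue⇒source G s v₁v₂ deg₁ deg₂ t (inj₁ (all-blue v₁))
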